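{- Let $(G_n)_{n\ge0}$ be a decreasing sequence of complete abelian topological groups, where the topology of $G_n$ is given by a basis of neighbourhoods of $0$ consisting of open subgroups $(G_n^{(i)})_{i\ge0}$ with $G_n=G_n^{(0)}$, and assume $G_{n+1}^{(i)}\subset G_n^{(i)}$ for all $i,n$. Suppose there is a subgroup $H\subset\bigcap_nG_n$ which is closed in each $G_n$, i.e. $H=\bigcap_i(H+G_n^{(i)})$ for all $n$, and a constant $c$ independent of $i,n$ such that \[G^{(i)}_{n+c}\subset H+G^{(i+1)}_n\quad\text{for all }i,n.\] Then $\bigcap_nG_n=\varprojlim_nG_n=H$ and $R^1\varprojlim_nG_n=0$.
   Context: $R^1\varprojlim_n$ denotes the first derived functor of the inverse limit for inverse systems of abelian groups indexed by $\mathbb{N}$; here the inverse system is given by the inclusions $G_{n+1}\subset G_n$. -}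

module Defs where

open import Level using (_⊔_)
open import Algebra.Bundles using (AbelianGroup)
open import Data.Nat using (ℕ; zero; suc; _≤_)
open import Data.Product using (Σ; ∃; ∃₂; _×_)
open import Relation.Unary using (Pred; _⊆_)

-- Everything lives inside an ambient abelian group A (written multiplicatively
-- by the stdlib: _∙_, ε, _⁻¹, with setoid equality _≈_).  Since G_{n+1} ⊂ G_n,
-- all G_n, G_n^{(i)}, H are subgroups of the ambient group G_0 ⊆ A.
module _ {a ℓ} (A : AbelianGroup a ℓ) where
  open AbelianGroup A renaming (Carrier to X)

  record IsSubgroup {p} (P : Pred X p) : Set (a ⊔ ℓ ⊔ p) where
    field
      resp : ∀ {x y} → x ≈ y → P x → P y
      ε∈   : P ε
      ∙∈   : ∀ {x y} → P x → P y → P (x ∙ y)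
      ⁻¹∈  : ∀ {x} → P x → P (x ⁻¹)

  _⊕_ : ∀ {p q} → Pred X p → Pred X q → Pred X (a ⊔ ℓ ⊔ p ⊔ q)
  (P ⊕ Q) x = ∃₂ λ h g → P h × Q g × x ≈ h ∙ g

  -- A descending chain of subgroups F 0 ⊇ F 1 ⊇ ... : the basis of open
  -- subgroups (neighbourhoods of 0) defining the topology on F 0.
  record IsSubgroupFiltration {p} (F : ℕ → Pred X p) : Set (a ⊔ ℓ ⊔ p) where
    field
      subgroup   : ∀ i → IsSubgroup (F i)
      decreasing : ∀ i → F (suc i) ⊆ F i

  IsCauchy : ∀ {p} → (F : ℕ → Pred X p) → (ℕ → X) → Set p
  IsCauchy F s = ∀ i → ∃ λ N → ∀ m k → N ≤ m → N ≤ k → F i (s m ∙ s k ⁻¹)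

  ConvergesTo : ∀ {p} → (F : ℕ → Pred X p) → (ℕ → X) → X → Set p
  ConvergesTo F s x = ∀ i → ∃ λ N → ∀ m → N ≤ m → F i (s m ∙ x ⁻¹)

  IsComplete : ∀ {p} → (F : ℕ → Pred X p) → Set (a ⊔ p)
  IsComplete F = ∀ s → (∀ m → F 0 (s m)) → IsCauchy F s →
                 ∃ λ x → F 0 x × ConvergesTo F s x

  ⋂ : ∀ {p} → (ℕ → Pred X p) → Pred X p
  ⋂ P x = ∀ n → P n x

  -- R¹lim_n of the tower G 0 ⊇ G 1 ⊇ ... (transition maps = inclusions) is the
  -- cokernel of  ∏ G_n → ∏ G_n,  (x_n) ↦ (x_n − x_{n+1}).
  -- R¹lim = 0 means this map is surjective.
  R1LimVanishes : ∀ {p} → (ℕ → Pred X p) → Set (a ⊔ ℓ ⊔ p)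
  R1LimVanishes G = ∀ (y : ℕ → X) → (∀ n → G n (y n)) →
    ∃ λ (x : ℕ → X) → (∀ n → G n (x n)) × (∀ n → y n ≈ x n ∙ x (suc n) ⁻¹)

  -- The inverse limit of a tower of subgroups with inclusions as transition maps:
  -- compatible sequences (x_n), x_n ∈ G_n, x_{n+1} = x_n.
  InvLim : ∀ {p} → (ℕ → Pred X p) → Set (a ⊔ ℓ ⊔ p)
  InvLim G = Σ (ℕ → X) λ x → (∀ n → G n (x n)) × (∀ n → x (suc n) ≈ x n)

{-# OPTIONS --safe #-}
module Submission where

-- Iterating  G (n + c) i ⊆ H + G n (i + 1)  gives  G (k c + m) 0 ⊆ H + G m k, so an
-- x ∈ ⋂ G n lies in H + G 0 k for every k, hence in the closed subgroup H.
-- For R¹lim, split y k ∈ G k as h k + z k with h k ∈ H and z k ∈ G j j, where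
-- j = ⌊k/(c+1)⌋; then z k → 0 in every G n, so the tails z n + z (n+1) + ⋯ have sums
-- L n ∈ G n.  Put x n = L 0 − (y 0 + ⋯ + y (n−1)); then x n − x (n+1) = y n, and
-- x n = (L 0 − (z 0 + ⋯ + z (n−1)) − L n) + (L n − (h 0 + ⋯ + h (n−1))), where the
-- first term compares two limits in G 0 of the same series, so lies in ⋂ i G 0 i ⊆ H.

open import Defs
open import Algebra.Bundles using (AbelianGroup; Group)
open import Data.Nat using (ℕ; zero; suc; z≤n; _+_; _*_; _≤_; _≤′_; ≤′-refl; ≤′-step; _/_)
open import Data.Nat.Properties using (+-suc; +-comm; +-identityʳ; *-suc; ≤-trans; m≤m+n; m≤n+m; ≤⇒≤′; m≤n⇒∃[o]m+o≡n)
open import Data.Nat.DivMod using (m*n/n≡m; m/n*n≤m; /-monoˡ-≤)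
open import Data.Nat.Tactic.RingSolver using (solve-∀)
open import Data.Product using (_×_; _,_; Σ; ∃; proj₁; proj₂)
open import Relation.Unary using (Pred; _⊆_)
import Relation.Binary.PropositionalEquality as ≡
open ≡ using (_≡_; subst)

⊆-antitone : ∀ {a p} {X : Set a} {P : ℕ → Pred X p} →
             (∀ n → P (suc n) ⊆ P n) → ∀ {m n} → m ≤ n → P n ⊆ P m
⊆-antitone {P = P} step m≤n = go (≤⇒≤′ m≤n)
  where
  go : ∀ {m n} → m ≤′ n → P n ⊆ P m
  go ≤′-refl         x∈ = x∈
  go (≤′-step m≤′n) x∈ = go m≤′n (step _ x∈)

module _ {a ℓ} (A : AbelianGroup a ℓ) where
  open AbelianGroup A renaming (Carrier to X)
  open Group group using (_//_)
  open import Algebra.Properties.AbelianGroup A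
  open import Algebra.Properties.CommutativeSemigroup commutativeSemigroup using (interchange)
  open import Relation.Binary.Reasoning.Setoid setoid

  ∙-//-cancelʳ : ∀ x y z → (x ∙ z) // (y ∙ z) ≈ x // y
  ∙-//-cancelʳ x y z = begin
    (x ∙ z) ∙ (y ∙ z) ⁻¹      ≈⟨ ∙-congˡ (⁻¹-anti-homo-∙ y z) ⟩
    (x ∙ z) ∙ (z ⁻¹ ∙ y ⁻¹)   ≈⟨ assoc x z _ ⟩
    x ∙ (z ∙ (z ⁻¹ ∙ y ⁻¹))   ≈⟨ ∙-congˡ (\\-leftDividesˡ z (y ⁻¹)) ⟩
    x // y                    ∎

  ∙-//-cancelˡ : ∀ x y z → (x ∙ y) // (x ∙ z) ≈ y // z
  ∙-//-cancelˡ x y z = begin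
    (x ∙ y) // (x ∙ z) ≈⟨ //-cong₂ (comm x y) (comm x z) ⟩
    (y ∙ x) // (z ∙ x) ≈⟨ ∙-//-cancelʳ y z x ⟩
    y // z             ∎

  //-//-cancel : ∀ t x y → (t // y) // (t // x) ≈ x // y
  //-//-cancel t x y = begin
    (t ∙ y ⁻¹) // (t ∙ x ⁻¹) ≈⟨ ∙-//-cancelˡ t (y ⁻¹) (x ⁻¹) ⟩
    y ⁻¹ ∙ x ⁻¹ ⁻¹           ≈⟨ ∙-congˡ (⁻¹-involutive x) ⟩
    y ⁻¹ ∙ x                 ≈⟨ comm (y ⁻¹) x ⟩
    x // y                   ∎

  //-telescope : ∀ u v w → (u // v) // (u // (v ∙ w)) ≈ w
  //-telescope u v w = begin
    (u ∙ v ⁻¹) // (u ∙ (v ∙ w) ⁻¹) ≈⟨ ∙-//-cancelˡ u (v ⁻¹) ((v ∙ w) ⁻¹) ⟩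
    v ⁻¹ ∙ (v ∙ w) ⁻¹ ⁻¹           ≈⟨ ∙-congˡ (⁻¹-involutive (v ∙ w)) ⟩
    v ⁻¹ ∙ (v ∙ w)                 ≈⟨ \\-leftDividesʳ v w ⟩
    w                              ∎

  //-regroup : ∀ u v w t → u // (v ∙ w) ≈ (u // (w ∙ t)) ∙ (t // v)
  //-regroup u v w t = sym (begin
    (u ∙ (w ∙ t) ⁻¹) ∙ (t ∙ v ⁻¹) ≈⟨ interchange u _ t _ ⟩
    (u ∙ t) ∙ ((w ∙ t) ⁻¹ ∙ v ⁻¹) ≈⟨ ∙-congˡ (⁻¹-∙-comm (w ∙ t) v) ⟩
    (u ∙ t) // ((w ∙ t) ∙ v)      ≈⟨ ∙-congˡ (⁻¹-cong (comm (w ∙ t) v)) ⟩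
    (u ∙ t) // (v ∙ (w ∙ t))      ≈⟨ ∙-congˡ (⁻¹-cong (assoc v w t)) ⟨
    (u ∙ t) // ((v ∙ w) ∙ t)      ≈⟨ ∙-//-cancelʳ u (v ∙ w) t ⟩
    u // (v ∙ w)                  ∎)

  ∑ : (ℕ → X) → ℕ → X
  ∑ f zero    = ε
  ∑ f (suc t) = ∑ f t ∙ f t

  ∑-split : ∀ f n m → ∑ f (n + m) ≈ ∑ f n ∙ ∑ (λ k → f (n + k)) m
  ∑-split f n zero rewrite +-identityʳ n = sym (identityʳ (∑ f n))
  ∑-split f n (suc m) rewrite +-suc n m = begin
    ∑ f (n + m) ∙ f (n + m)                               ≈⟨ ∙-congʳ (∑-split f n m) ⟩
    (∑ f n ∙ ∑ (λ k → f (n + k)) m) ∙ f (n + m)           ≈⟨ assoc _ _ _ ⟩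
    ∑ f n ∙ (∑ (λ k → f (n + k)) m ∙ f (n + m))           ∎

  ∑-∙ : ∀ {f g h} → (∀ k → f k ≈ g k ∙ h k) → ∀ t → ∑ f t ≈ ∑ g t ∙ ∑ h t
  ∑-∙ f≈g∙h zero    = sym (identityˡ ε)
  ∑-∙ f≈g∙h (suc t) = trans (∙-cong (∑-∙ f≈g∙h t) (f≈g∙h t)) (interchange _ _ _ _)

  module _ {p} {P : Pred X p} (P-subgroup : IsSubgroup A P) where
    open IsSubgroup P-subgroup

    //∈ : ∀ {x y} → P x → P y → P (x // y)
    //∈ x∈ y∈ = ∙∈ x∈ (⁻¹∈ y∈)

    ∑∈ : ∀ {f} → (∀ k → P (f k)) → ∀ t → P (∑ f t)
    ∑∈ f∈ zero    = ε∈
    ∑∈ f∈ (suc t) = ∙∈ (∑∈ f∈ t) (f∈ t)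

    Q⊆P⊕Q : ∀ {q} {Q : Pred X q} → Q ⊆ _⊕_ A P Q
    Q⊆P⊕Q {x = x} x∈ = ε , x , ε∈ , x∈ , sym (identityˡ x)

    ⊕-absorbˡ : ∀ {q} {Q : Pred X q} → _⊕_ A P (_⊕_ A P Q) ⊆ _⊕_ A P Q
    ⊕-absorbˡ (h , _ , h∈ , (h′ , g , h′∈ , g∈ , e′) , e) =
      h ∙ h′ , g , ∙∈ h∈ h′∈ , g∈ , trans e (trans (∙-congˡ e′) (sym (assoc h h′ g)))

  ⊕-monoʳ : ∀ {p q r} {P : Pred X p} {Q : Pred X q} {R : Pred X r} →
            Q ⊆ R → _⊕_ A P Q ⊆ _⊕_ A P R
  ⊕-monoʳ Q⊆R (h , g , h∈ , g∈ , e) = h , g , h∈ , Q⊆R g∈ , e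

  TendsToZero : ∀ {p} → (ℕ → Pred X p) → (ℕ → X) → Set p
  TendsToZero F w = ∀ i → ∃ λ N → ∀ k → N ≤ k → F i (w k)

  converges-shift : ∀ {p} {F : ℕ → Pred X p} {s x} n →
                    ConvergesTo A F s x → ConvergesTo A F (λ m → s (n + m)) x
  converges-shift n s→x i =
    let N , close = s→x i in N , λ m N≤m → close (n + m) (≤-trans N≤m (m≤n+m m n))

  converges-mono : ∀ {p q} {F : ℕ → Pred X p} {F′ : ℕ → Pred X q} {s x} →
                   (∀ i → F′ i ⊆ F i) → ConvergesTo A F′ s x → ConvergesTo A F s x
  converges-mono F′⊆F s→x i = let N , close = s→x i in N , λ m N≤m → F′⊆F i (close m N≤m)

  module _ {p} {F : ℕ → Pred X p} (F-filtration : IsSubgroupFiltration A F) where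
    open IsSubgroupFiltration F-filtration
    module F i = IsSubgroup (subgroup i)

    converges-translate : ∀ {s x} u → ConvergesTo A F s x →
                          ConvergesTo A F (λ m → u ∙ s m) (u ∙ x)
    converges-translate {s} {x} u s→x i = let N , close = s→x i in
      N , λ m N≤m → F.resp i (sym (∙-//-cancelˡ u (s m) x)) (close m N≤m)

    limits-close : ∀ {s s′ x y} → (∀ m → s m ≈ s′ m) →
                   ConvergesTo A F s x → ConvergesTo A F s′ y → ∀ i → F i (x // y)
    limits-close {s} {s′} {x} {y} s≈s′ s→x s′→y i =
      let N , s-close = s→x i ; N′ , s′-close = s′→y i ; m = N + N′ in
      F.resp i (//-//-cancel (s m) x y)
        (//∈ (subgroup i) (F.resp i (∙-congʳ (sym (s≈s′ m))) (s′-close m (m≤n+m N′ N)))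
                          (s-close m (m≤m+n N N′)))

    ∑-tail∈ : ∀ {w i N} → (∀ k → N ≤ k → F i (w k)) →
              ∀ m → N ≤ m → F i (∑ w m // ∑ w N)
    ∑-tail∈ {w} {i} {N} small m N≤m with m≤n⇒∃[o]m+o≡n N≤m
    ... | t , ≡.refl = F.resp i (sym (trans (∙-congʳ (∑-split w N t)) (xyx⁻¹≈y _ _)))
                       (∑∈ (subgroup i) (λ k → small (N + k) (m≤m+n N k)) t)

    ∑-cauchy : ∀ {w} → TendsToZero F w → IsCauchy A F (∑ w)
    ∑-cauchy {w} w→0 i = let N , small = w→0 i in
      N , λ m k N≤m N≤k → F.resp i (∙-//-cancelʳ (∑ w m) (∑ w k) (∑ w N ⁻¹))
        (//∈ (subgroup i) (∑-tail∈ small m N≤m) (∑-tail∈ small k N≤k))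

    ∑-summable : IsComplete A F → ∀ {w} → (∀ k → F 0 (w k)) → TendsToZero F w →
                 ∃ λ L → F 0 L × ConvergesTo A F (∑ w) L
    ∑-summable complete w∈ w→0 = complete (∑ _) (∑∈ (subgroup 0) w∈) (∑-cauchy w→0)

  module Tower {p} (G : ℕ → ℕ → Pred X p) (H : Pred X p) (c : ℕ)
      (G-filtration : ∀ n → IsSubgroupFiltration A (G n))
      (G-complete : ∀ n → IsComplete A (G n))
      (G-decreasing : ∀ n i → G (suc n) i ⊆ G n i)
      (H-subgroup : IsSubgroup A H)
      (H⊆⋂G : H ⊆ ⋂ A (λ n → G n 0))
      (H-closed : ∀ n → ⋂ A (λ i → _⊕_ A H (G n i)) ⊆ H)
      (G-approx : ∀ i n → G (n + c) i ⊆ _⊕_ A H (G n (suc i))) where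

    module G n i = IsSubgroup (IsSubgroupFiltration.subgroup (G-filtration n) i)

    G-antitoneₙ : ∀ {m n i} → m ≤ n → G n i ⊆ G m i
    G-antitoneₙ {i = i} = ⊆-antitone (λ n → G-decreasing n i)

    G-antitoneᵢ : ∀ {n i j} → i ≤ j → G n j ⊆ G n i
    G-antitoneᵢ {n} = ⊆-antitone (IsSubgroupFiltration.decreasing (G-filtration n))

    G-approx-iterated : ∀ k m → G (k * c + m) 0 ⊆ _⊕_ A H (G m k)
    G-approx-iterated zero    m x∈ = Q⊆P⊕Q H-subgroup x∈
    G-approx-iterated (suc k) m {x} x∈ =
      ⊕-absorbˡ H-subgroup (⊕-monoʳ (G-approx k m)
        (G-approx-iterated k (m + c) (subst (λ n → G n 0 x) (reindex k m c) x∈)))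
      where
      reindex : ∀ k m c → suc k * c + m ≡ k * c + (m + c)
      reindex = solve-∀

    ⋂G0⊆H : ⋂ A (G 0) ⊆ H
    ⋂G0⊆H x∈ = H-closed 0 (λ i → Q⊆P⊕Q H-subgroup (x∈ i))

    ⋂G⊆H : ⋂ A (λ n → G n 0) ⊆ H
    ⋂G⊆H x∈ = H-closed 0 (λ k → G-approx-iterated k 0 (x∈ (k * c + 0)))

    InvLim⊆H : ∀ (x : InvLim A (λ n → G n 0)) → ∀ n → H (proj₁ x n)
    InvLim⊆H (x , x∈ , x-compatible) n = IsSubgroup.resp H-subgroup (sym (x≈x0 n)) x0∈H
      where
      x≈x0 : ∀ n → x n ≈ x 0
      x≈x0 zero    = refl
      x≈x0 (suc n) = trans (x-compatible n) (x≈x0 n)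
      x0∈H : H (x 0)
      x0∈H = ⋂G⊆H (λ n → G.resp n 0 (x≈x0 n) (x∈ n))

    H⊆InvLim : ∀ h → H h → Σ (InvLim A (λ n → G n 0)) λ x → ∀ n → proj₁ x n ≈ h
    H⊆InvLim h h∈ = ((λ _ → h) , (λ n → H⊆⋂G h∈ n) , (λ _ → refl)) , (λ _ → refl)

    level : ℕ → ℕ
    level k = k / suc c

    level-spec : ∀ k → level k * c + level k ≤ k
    level-spec k = subst (_≤ k) (≡.trans (*-suc (level k) c) (+-comm (level k) (level k * c)))
                         (m/n*n≤m k (suc c))

    level-≥ : ∀ {m k} → m * suc c ≤ k → m ≤ level k
    level-≥ {m} {k} m[c+1]≤k = subst (_≤ level k) (m*n/n≡m m (suc c)) (/-monoˡ-≤ (suc c) m[c+1]≤k)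

    module Preimage (y : ℕ → X) (y∈G : ∀ n → G n 0 (y n)) where
      y-split : ∀ k → _⊕_ A H (G (level k) (level k)) (y k)
      y-split k = G-approx-iterated (level k) (level k) (G-antitoneₙ (level-spec k) (y∈G k))

      h z : ℕ → X
      h k = proj₁ (y-split k)
      z k = proj₁ (proj₂ (y-split k))

      h∈H : ∀ k → H (h k)
      h∈H k = proj₁ (proj₂ (proj₂ (y-split k)))

      z∈G-level : ∀ k → G (level k) (level k) (z k)
      z∈G-level k = proj₁ (proj₂ (proj₂ (proj₂ (y-split k))))

      y≈h∙z : ∀ k → y k ≈ h k ∙ z k
      y≈h∙z k = proj₂ (proj₂ (proj₂ (proj₂ (y-split k))))

      z∈G : ∀ k → G k 0 (z k)
      z∈G k = G.resp k 0 (trans (∙-congˡ (y≈h∙z k)) (\\-leftDividesʳ (h k) (z k)))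
                (G.∙∈ k 0 (G.⁻¹∈ k 0 (H⊆⋂G (h∈H k) k)) (y∈G k))

      z-small : ∀ n i k → (n + i) * suc c ≤ k → G n i (z k)
      z-small n i k le = G-antitoneᵢ (≤-trans (m≤n+m i n) n+i≤level)
                           (G-antitoneₙ (≤-trans (m≤m+n n i) n+i≤level) (z∈G-level k))
        where
        n+i≤level : n + i ≤ level k
        n+i≤level = level-≥ le

      tail : ℕ → ℕ → X
      tail n k = z (n + k)

      tail∈G : ∀ n k → G n 0 (tail n k)
      tail∈G n k = G-antitoneₙ (m≤m+n n k) (z∈G (n + k))

      tail→0 : ∀ n → TendsToZero (G n) (tail n)
      tail→0 n i = (n + i) * suc c , λ k le → z-small n i (n + k) (≤-trans le (m≤n+m k n))

      tail-sum : ∀ n → ∃ λ L → G n 0 L × ConvergesTo A (G n) (∑ (tail n)) L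
      tail-sum n = ∑-summable (G-filtration n) (G-complete n) (tail∈G n) (tail→0 n)

      L : ℕ → X
      L n = proj₁ (tail-sum n)

      L∈G : ∀ n → G n 0 (L n)
      L∈G n = proj₁ (proj₂ (tail-sum n))

      ∑tail→L : ∀ n → ConvergesTo A (G n) (∑ (tail n)) (L n)
      ∑tail→L n = proj₂ (proj₂ (tail-sum n))

      discrepancy∈H : ∀ n → H (L 0 // (∑ z n ∙ L n))
      discrepancy∈H n = ⋂G0⊆H (limits-close (G-filtration 0) (∑-split z n)
        (converges-shift {F = G 0} n (∑tail→L 0))
        (converges-translate (G-filtration 0) (∑ z n)
          (converges-mono {F = G 0} (λ i → G-antitoneₙ z≤n) (∑tail→L n))))

      x : ℕ → X
      x n = L 0 // ∑ y n

      x∈G : ∀ n → G n 0 (x n)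
      x∈G n = G.resp n 0 (sym x≈)
        (G.∙∈ n 0 (H⊆⋂G (discrepancy∈H n) n)
                  (//∈ (IsSubgroupFiltration.subgroup (G-filtration n) 0)
                       (L∈G n) (H⊆⋂G (∑∈ H-subgroup h∈H n) n)))
        where
        x≈ : x n ≈ (L 0 // (∑ z n ∙ L n)) ∙ (L n // ∑ h n)
        x≈ = trans (∙-congˡ (⁻¹-cong (∑-∙ y≈h∙z n))) (//-regroup (L 0) (∑ h n) (∑ z n) (L n))

    R¹lim-vanishes : R1LimVanishes A (λ n → G n 0)
    R¹lim-vanishes y y∈G = x , x∈G , λ n → sym (//-telescope (L 0) (∑ y n) (y n))
      where open Preimage y y∈G

mainTheorem11 : ∀ {a ℓ p} (A : AbelianGroup a ℓ)
    (G : ℕ → ℕ → Pred (AbelianGroup.Carrier A) p)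
    (H : Pred (AbelianGroup.Carrier A) p) (c : ℕ) →
    (∀ n → IsSubgroupFiltration A (G n)) →
    (∀ n → IsComplete A (G n)) →
    (∀ n i → G (suc n) i ⊆ G n i) →
    IsSubgroup A H →
    H ⊆ ⋂ A (λ n → G n 0) →
    (∀ n → ⋂ A (λ i → _⊕_ A H (G n i)) ⊆ H) →
    (∀ i n → G (n + c) i ⊆ _⊕_ A H (G n (suc i))) →
    ((⋂ A (λ n → G n 0) ⊆ H) × (H ⊆ ⋂ A (λ n → G n 0)))
    × ((∀ (x : InvLim A (λ n → G n 0)) → ∀ n → H (proj₁ x n))
    × (∀ h → H h → Σ (InvLim A (λ n → G n 0)) λ x → ∀ n → AbelianGroup._≈_ A (proj₁ x n) h))
    × R1LimVanishes A (λ n → G n 0)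
mainTheorem11 A G H c G-filtration G-complete G-decreasing H-subgroup H⊆⋂G H-closed G-approx =
  (⋂G⊆H , H⊆⋂G) , (InvLim⊆H , H⊆InvLim) , R¹lim-vanishes
  where
  open Tower A G H c G-filtration G-complete G-decreasing H-subgroup H⊆⋂G H-closed G-approx
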